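{- Assume $\mathbb T$ is propositionally stable and (SQCI) holds. For any $\mathbb I$-algebra $A$, \[ L\operatorname{Spec}A\cong\sum_{i:\mathbb I}\mathbb I\text{ - }\mathbf{Alg}(A,\mathbb I/i), \] where $\mathbb I/i$ denotes the quotient $\mathbb I/(i=1)$.
   Context: We work in intensional type theory with function extensionality. $\mathbb I$ is a model of a Horn theory $\mathbb T$; an $\mathbb I$-algebra is a $\mathbb T$-model with a homomorphism from $\mathbb I$. $\operatorname{Spec}A:=\mathbb I\text{ - }\mathbf{Alg}(A,\mathbb I)$; $\mathcal O X:=\mathbb I^X$. $A$ is quasi-coherent if $\iota_A:A\to\mathcal O\operatorname{Spec}A$, $a\mapsto(x\mapsto x(a))$, is an isomorphism; stably quasi-coherent if all quotients $A/(a=b)$ ($n:\mathbb N$, $a,b:n\to A$) are quasi-coherent. (SQCI): $\mathbb I$ is stably quasi-coherent. $\mathbb T$ is propositionally stable if it extends bounded meet-semilattices and for each model $A$ and $a:A$ the quotient $A/(a=1)$ is $a\wedge-:A\to{\downarrow}a$. $LX:=\sum_{i:\mathbb I}X^{(i=1)}$. -}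

module Defs where

open import Level using (0ℓ)
open import Data.Nat using (ℕ; zero; suc)
open import Data.Fin using (Fin; zero; suc)
open import Data.Product using (Σ; _×_; _,_; proj₁; proj₂; Σ-syntax)
open import Relation.Binary.Bundles using (Setoid)
open import Function.Bundles using (Func)

record Signature : Set₁ where
  field Op : ℕ → Set

data Term (S : Signature) (n : ℕ) : Set where
  var : Fin n → Term S n
  op  : ∀ {k} → Signature.Op S k → (Fin k → Term S n) → Term S n

record Equation (S : Signature) (n : ℕ) : Set where
  constructor _≐_
  field lhs rhs : Term S n

record HornClause (S : Signature) : Set where
  field
    ctx   : ℕ
    #hyps : ℕ
    hyp   : Fin #hyps → Equation S ctx
    concl : Equation S ctx

record Theory : Set₁ where
  field
    sig    : Signature
    Axiom  : Set
    clause : Axiom → HornClause sig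

eval : ∀ {S : Signature} {C : Set} →
       (∀ {k} → Signature.Op S k → (Fin k → C) → C) →
       ∀ {n} → Term S n → (Fin n → C) → C
eval I (var j)   ρ = ρ j
eval I (op f ts) ρ = I f (λ j → eval I (ts j) ρ)

Holds : ∀ {S : Signature} {C : Set} → (C → C → Set) →
        (∀ {k} → Signature.Op S k → (Fin k → C) → C) →
        ∀ {n} → Equation S n → (Fin n → C) → Set
Holds R I (l ≐ r) ρ = R (eval I l ρ) (eval I r ρ)

module _ {T : Theory} where
  open Theory T
  open Signature sig
  open HornClause

  record Model : Set₁ where
    field
      setoid : Setoid 0ℓ 0ℓ
    open Setoid setoid public
    field
      interp      : ∀ {k} → Op k → (Fin k → Carrier) → Carrier
      interp-cong : ∀ {k} (f : Op k) {xs ys : Fin k → Carrier} →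
                    (∀ j → xs j ≈ ys j) → interp f xs ≈ interp f ys
      sat         : (α : Axiom) (ρ : Fin (ctx (clause α)) → Carrier) →
                    (∀ j → Holds _≈_ interp (hyp (clause α) j) ρ) →
                    Holds _≈_ interp (concl (clause α)) ρ

  record Hom (A B : Model) : Set where
    private
      module A = Model A
      module B = Model B
    field
      fun : Func A.setoid B.setoid
    open Func fun public
    field
      preserves : ∀ {k} (f : Op k) (xs : Fin k → A.Carrier) →
                  to (A.interp f xs) B.≈ B.interp f (λ j → to (xs j))

  idHom : (A : Model) → Hom A A
  idHom A = record
    { fun = record { to = λ x → x ; cong = λ e → e }
    ; preserves = λ f xs → Model.refl A }

  module _ (I : Model) where
    private module I = Model I

    record IAlg : Set₁ where
      field
        model : Model
        str   : Hom I model
      open Model model public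

    record IHom (A B : IAlg) : Set where
      private
        module A = IAlg A
        module B = IAlg B
      field
        hom  : Hom A.model B.model
      open Hom hom public
      field
        comm : ∀ i → to (Hom.to A.str i) B.≈ Hom.to B.str i

    𝕀ₐ : IAlg
    𝕀ₐ = record { model = I ; str = idHom I }

    IAlgHomSetoid : IAlg → IAlg → Setoid 0ℓ 0ℓ
    IAlgHomSetoid A B = record
      { Carrier = IHom A B
      ; _≈_ = λ h k → ∀ x → IHom.to h x B.≈ IHom.to k x
      ; isEquivalence = record
        { refl = λ x → B.refl
        ; sym = λ e x → B.sym (e x)
        ; trans = λ e e' x → B.trans (e x) (e' x) } }
      where module B = IAlg B

    Spec : IAlg → Setoid 0ℓ 0ℓ
    Spec A = IAlgHomSetoid A 𝕀ₐ

    module _ (X : Setoid 0ℓ 0ℓ) where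
      private module X = Setoid X

      FunSetoid : Setoid 0ℓ 0ℓ
      FunSetoid = record
        { Carrier = Func X I.setoid
        ; _≈_ = λ φ ψ → ∀ x → Func.to φ x I.≈ Func.to ψ x
        ; isEquivalence = record
          { refl = λ x → I.refl
          ; sym = λ e x → I.sym (e x)
          ; trans = λ e e' x → I.trans (e x) (e' x) } }

      funInterp : ∀ {k} → Op k → (Fin k → Func X I.setoid) → Func X I.setoid
      funInterp f φs = record
        { to = λ x → I.interp f (λ j → Func.to (φs j) x)
        ; cong = λ e → I.interp-cong f (λ j → Func.cong (φs j) e) }

      eval-pt : ∀ {n} (t : Term sig n) (ρ : Fin n → Func X I.setoid) (x : X.Carrier) →
                Func.to (eval funInterp t ρ) x I.≈ eval I.interp t (λ j → Func.to (ρ j) x)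
      eval-pt (var j)   ρ x = I.refl
      eval-pt (op f ts) ρ x = I.interp-cong f (λ j → eval-pt (ts j) ρ x)

      𝒪model : Model
      𝒪model = record
        { setoid = FunSetoid
        ; interp = funInterp
        ; interp-cong = λ f e x → I.interp-cong f (λ j → e j x)
        ; sat = λ α ρ hs x →
            let c = concl (clause α) in
            I.trans (eval-pt (Equation.lhs c) ρ x)
              (I.trans (I.sat α (λ j → Func.to (ρ j) x)
                 (λ j → I.trans (I.sym (eval-pt (Equation.lhs (hyp (clause α) j)) ρ x))
                          (I.trans (hs j x) (eval-pt (Equation.rhs (hyp (clause α) j)) ρ x))))
                 (I.sym (eval-pt (Equation.rhs c) ρ x))) }

      𝒪 : IAlg
      𝒪 = record
        { model = 𝒪model
        ; str = record
          { fun = record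
            { to = λ i → record { to = λ _ → i ; cong = λ _ → I.refl }
            ; cong = λ e x → e }
          ; preserves = λ f xs x → I.refl } }

    ι : (A : IAlg) → IHom A (𝒪 (Spec A))
    ι A = record
      { hom = record
        { fun = record
          { to = λ a → record { to = λ φ → IHom.to φ a ; cong = λ e → e a }
          ; cong = λ e φ → IHom.cong φ e }
        ; preserves = λ f xs φ → IHom.preserves φ f xs }
      ; comm = λ i φ → IHom.comm φ i }

    IsIso : {A B : IAlg} → IHom A B → Set
    IsIso {A} {B} h =
      Σ[ g ∈ IHom B A ] ((∀ a → IHom.to g (IHom.to h a) A.≈ a) ×
                         (∀ b → IHom.to h (IHom.to g b) B.≈ b))
      where
        module A = IAlg A
        module B = IAlg B

    QuasiCoherent : IAlg → Set
    QuasiCoherent A = IsIso (ι A)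

  -- Quotients  M/(a = b)  for a, b : Fin n → M:  the least congruence
  -- containing ≈ and the pairs (a k, b k), closed under the Horn axioms.

  module _ (M : Model) where
    private module M = Model M

    data Gen {n : ℕ} (a b : Fin n → M.Carrier) : M.Carrier → M.Carrier → Set where
      base   : ∀ {x y} → x M.≈ y → Gen a b x y
      gen    : (k : Fin n) → Gen a b (a k) (b k)
      gsym   : ∀ {x y} → Gen a b x y → Gen a b y x
      gtrans : ∀ {x y z} → Gen a b x y → Gen a b y z → Gen a b x z
      gcong  : ∀ {k} (f : Op k) {xs ys : Fin k → M.Carrier} →
               (∀ j → Gen a b (xs j) (ys j)) → Gen a b (M.interp f xs) (M.interp f ys)
      gax    : (α : Axiom) (ρ : Fin (ctx (clause α)) → M.Carrier) →
               (∀ j → Holds (Gen a b) M.interp (hyp (clause α) j) ρ) →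
               Holds (Gen a b) M.interp (concl (clause α)) ρ

    QuotModel : (n : ℕ) (a b : Fin n → M.Carrier) → Model
    QuotModel n a b = record
      { setoid = record
        { Carrier = M.Carrier
        ; _≈_ = Gen a b
        ; isEquivalence = record
          { refl = base M.refl ; sym = gsym ; trans = gtrans } }
      ; interp = M.interp
      ; interp-cong = gcong
      ; sat = gax }

  Quot : {I : Model} (A : IAlg I) (n : ℕ) (a b : Fin n → IAlg.Carrier A) → IAlg I
  Quot A n a b = record
    { model = QuotModel (IAlg.model A) n a b
    ; str = record
      { fun = record { to = Hom.to (IAlg.str A) ; cong = λ e → base (Hom.cong (IAlg.str A) e) }
      ; preserves = λ f xs → base (Hom.preserves (IAlg.str A) f xs) } }

  SQCI : (I : Model) → Set
  SQCI I = ∀ (n : ℕ) (a b : Fin n → Model.Carrier I) → QuasiCoherent I (Quot (𝕀ₐ I) n a b)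

  pair : ∀ {C : Set} → C → C → Fin 2 → C
  pair x y zero       = x
  pair x y (suc zero) = y

  meetIn : Op 2 → (M : Model) → Model.Carrier M → Model.Carrier M → Model.Carrier M
  meetIn m M x y = Model.interp M m (pair x y)

  topIn : Op 0 → (M : Model) → Model.Carrier M
  topIn t M = Model.interp M t (λ ())

  record PropStable : Set₁ where
    field
      meet : Op 2
      top  : Op 0
    private
      _⊓_ : (M : Model) → Model.Carrier M → Model.Carrier M → Model.Carrier M
      _⊓_ = meetIn meet
      𝟙 : (M : Model) → Model.Carrier M
      𝟙 = topIn top
    field
      -- T extends the theory of bounded meet-semilattices
      ⊓-idem  : (M : Model) → ∀ x → Model._≈_ M (_⊓_ M x x) x
      ⊓-comm  : (M : Model) → ∀ x y → Model._≈_ M (_⊓_ M x y) (_⊓_ M y x)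
      ⊓-assoc : (M : Model) → ∀ x y z →
                Model._≈_ M (_⊓_ M (_⊓_ M x y) z) (_⊓_ M x (_⊓_ M y z))
      ⊓-𝟙     : (M : Model) → ∀ x → Model._≈_ M (_⊓_ M x (𝟙 M)) x
      -- the quotient M/(a = 1) is  a ⊓ - : M → ↓a,  i.e. the map
      -- x ↦ a ⊓ x  is well defined and bijective from M/(a=1) onto ↓a
      stable-resp : (M : Model) (a : Model.Carrier M) → ∀ x y →
                    Gen M (λ (_ : Fin 1) → a) (λ _ → 𝟙 M) x y →
                    Model._≈_ M (_⊓_ M a x) (_⊓_ M a y)
      stable-inj  : (M : Model) (a : Model.Carrier M) → ∀ x y →
                    Model._≈_ M (_⊓_ M a x) (_⊓_ M a y) →
                    Gen M (λ (_ : Fin 1) → a) (λ _ → 𝟙 M) x y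
      stable-surj : (M : Model) (a : Model.Carrier M) → ∀ y →
                    Model._≈_ M (_⊓_ M y a) y →
                    Σ[ x ∈ Model.Carrier M ] Model._≈_ M (_⊓_ M a x) y

  -- L X := Σ (i : 𝕀) X^(i = 1),  and  Σ (i : 𝕀) 𝕀-Alg(A, 𝕀/(i=1))

  module _ (P : PropStable) (I : Model) where
    private module I = Model I
    𝟙 : (M : Model) → Model.Carrier M
    𝟙 = topIn (PropStable.top P)

    L : Setoid 0ℓ 0ℓ → Setoid 0ℓ 0ℓ
    L X = record
      { Carrier = Σ[ i ∈ I.Carrier ] Σ[ f ∈ (i I.≈ 𝟙 I → X.Carrier) ] (∀ p q → f p X.≈ f q)
      ; _≈_ = λ { (i , f , _) (j , g , _) → (i I.≈ j) × (∀ p q → f p X.≈ g q) }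
      ; isEquivalence = record
        { refl = λ { {i , f , r} → I.refl , r }
        ; sym = λ { (e , h) → I.sym e , λ p q → X.sym (h q p) }
        ; trans = λ { (e , h) (e' , h') → I.trans e e' ,
                      λ p r → X.trans (h p (I.trans (I.sym e) p)) (h' (I.trans (I.sym e) p) r) } } }
      where module X = Setoid X

    𝕀/ : I.Carrier → IAlg I
    𝕀/ i = Quot (𝕀ₐ I) 1 (λ _ → i) (λ _ → 𝟙 I)

    private
      Gen-transport : ∀ {i j} → i I.≈ j → ∀ {x y} →
                      Gen I (λ (_ : Fin 1) → i) (λ _ → 𝟙 I) x y →
                      Gen I (λ (_ : Fin 1) → j) (λ _ → 𝟙 I) x y
      Gen-transport e (base x) = base x
      Gen-transport e (gen k) = gtrans (base e) (gen k)
      Gen-transport e (gsym g) = gsym (Gen-transport e g)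
      Gen-transport e (gtrans g g') = gtrans (Gen-transport e g) (Gen-transport e g')
      Gen-transport e (gcong f gs) = gcong f (λ j → Gen-transport e (gs j))
      Gen-transport e (gax α ρ gs) = gax α ρ (λ j → Gen-transport e (gs j))

    ΣAlg : IAlg I → Setoid 0ℓ 0ℓ
    ΣAlg A = record
      { Carrier = Σ[ i ∈ I.Carrier ] IHom I A (𝕀/ i)
      ; _≈_ = λ { (i , h) (j , k) →
                  (i I.≈ j) × (∀ x → Gen I (λ (_ : Fin 1) → i) (λ _ → 𝟙 I) (IHom.to h x) (IHom.to k x)) }
      ; isEquivalence = record
        { refl = I.refl , λ x → base I.refl
        ; sym = λ { (e , h) → I.sym e , λ x → Gen-transport e (gsym (h x)) }
        ; trans = λ { (e , h) (e' , h') → I.trans e e' ,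
                      λ x → gtrans (h x) (Gen-transport (I.sym e) (h' x)) } } }

-- Under (SQCI) the quotient 𝕀/(a = b) is quasi-coherent, and its spectrum is
-- just the proposition a = b: a point must identify a with b, and any proof
-- of a = b makes the identity of 𝕀 a point. Hence an element of 𝕀/(a = b) is
-- a (weakly constant) function from that proposition to 𝕀, and two elements
-- are equal in 𝕀/(a = b) as soon as they are equal under the assumption
-- a = b. A homomorphism A → 𝕀/i is therefore the same as an (i = 1)-indexed
-- family of points of Spec A, i.e. an element of L Spec A over i.
module Submission where

open import Defs
open import Data.Nat using (ℕ)
open import Data.Fin using (Fin; zero)
open import Data.Product using (_,_; proj₁; proj₂)
open import Data.Vec.Functional.Relation.Binary.Pointwise using (Pointwise)
open import Function.Bundles using (Inverse)
open import Function.Definitions using (Inverseˡ; Inverseʳ)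
import Function.Construct.Composition as Composition
import Function.Consequences.Setoid as Consequences
open import Relation.Binary.Bundles using (Setoid)

module _ {T : Theory} {I : Model {T}} where
  private module I = Model I

  _∘ᴵ_ : {A B C : IAlg I} → IHom I B C → IHom I A B → IHom I A C
  _∘ᴵ_ {C = C} g f = record
    { hom = record
      { fun = Composition.function (IHom.fun f) (IHom.fun g)
      ; preserves = λ op xs →
          C.trans (IHom.cong g (IHom.preserves f op xs))
                  (IHom.preserves g op (λ j → IHom.to f (xs j))) }
    ; comm = λ i → C.trans (IHom.cong g (IHom.comm f i)) (IHom.comm g i) }
    where module C = IAlg C

  module _ {n : ℕ} (a b : Fin n → I.Carrier) where
    private
      Q : IAlg I
      Q = Quot (𝕀ₐ I) n a b

    Gen⇒≈ : Pointwise I._≈_ a b → ∀ {x y} → Gen I a b x y → x I.≈ y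
    Gen⇒≈ a≈b (base e)      = e
    Gen⇒≈ a≈b (gen k)       = a≈b k
    Gen⇒≈ a≈b (gsym g)      = I.sym (Gen⇒≈ a≈b g)
    Gen⇒≈ a≈b (gtrans g g') = I.trans (Gen⇒≈ a≈b g) (Gen⇒≈ a≈b g')
    Gen⇒≈ a≈b (gcong f gs)  = I.interp-cong f (λ j → Gen⇒≈ a≈b (gs j))
    Gen⇒≈ a≈b (gax α ρ gs)  = I.sat α ρ (λ j → Gen⇒≈ a≈b (gs j))

    Quot-point : Pointwise I._≈_ a b → IHom I Q (𝕀ₐ I)
    Quot-point a≈b = record
      { hom = record
        { fun = record { to = λ x → x ; cong = Gen⇒≈ a≈b }
        ; preserves = λ f xs → I.refl }
      ; comm = λ i → I.refl }

    Quot-point⇒Pointwise : IHom I Q (𝕀ₐ I) → Pointwise I._≈_ a b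
    Quot-point⇒Pointwise φ k =
      I.trans (I.sym (IHom.comm φ (a k))) (I.trans (IHom.cong φ (gen k)) (IHom.comm φ (b k)))

    module _ (qc : QuasiCoherent I Q) where
      private
        ι⁻¹ : IHom I (𝒪 I (Spec I Q)) Q
        ι⁻¹ = proj₁ qc

      -- ι x ≈ ι y because every point of the quotient equalises a and b.
      conditional⇒Gen : ∀ {x y} → (Pointwise I._≈_ a b → x I.≈ y) → Gen I a b x y
      conditional⇒Gen {x} {y} x≈y =
        gtrans (gsym (proj₁ (proj₂ qc) x))
          (gtrans (IHom.cong ι⁻¹ λ φ →
                     I.trans (IHom.comm φ x)
                       (I.trans (x≈y (Quot-point⇒Pointwise φ)) (I.sym (IHom.comm φ y))))
                  (proj₁ (proj₂ qc) y))

      module _ (u : Pointwise I._≈_ a b → I.Carrier) (u-const : ∀ p q → u p I.≈ u q) where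
        glue : I.Carrier
        glue = IHom.to ι⁻¹ record
          { to = λ φ → u (Quot-point⇒Pointwise φ) ; cong = λ _ → u-const _ _ }

        -- ι ∘ ι⁻¹ = id, evaluated at the point Quot-point p.
        glue-β : ∀ p → glue I.≈ u p
        glue-β p = I.trans (proj₂ (proj₂ qc) _ (Quot-point p)) (u-const _ p)

      module _ {A : IAlg I} (f : Pointwise I._≈_ a b → IHom I A (𝕀ₐ I))
               (f-const : ∀ p q x → IHom.to (f p) x I.≈ IHom.to (f q) x) where
        private
          glueAt : IAlg.Carrier A → I.Carrier
          glueAt x = glue (λ p → IHom.to (f p) x) (λ p q → f-const p q x)

          β : ∀ x p → glueAt x I.≈ IHom.to (f p) x
          β x = glue-β (λ p → IHom.to (f p) x) (λ p q → f-const p q x)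

        glueHom : IHom I A Q
        glueHom = record
          { hom = record
            { fun = record
              { to = glueAt
              ; cong = λ {x} {y} x≈y → conditional⇒Gen λ p →
                  I.trans (β x p) (I.trans (IHom.cong (f p) x≈y) (I.sym (β y p))) }
            ; preserves = λ op xs → conditional⇒Gen λ p →
                I.trans (β _ p) (I.trans (IHom.preserves (f p) op xs)
                                         (I.interp-cong op λ j → I.sym (β (xs j) p))) }
          ; comm = λ i → conditional⇒Gen λ p → I.trans (β _ p) (IHom.comm (f p) i) }

        glueHom-β : ∀ p x → IHom.to glueHom x I.≈ IHom.to (f p) x
        glueHom-β p x = β x p

module _ {T : Theory} (P : PropStable {T}) (I : Model {T}) (sqci : SQCI I) (A : IAlg I) where
  private
    module I = Model I
    module LSpec = Setoid (L P I (Spec I A))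
    module ΣA = Setoid (ΣAlg P I A)

    one : I.Carrier
    one = 𝟙 P I I

    ⟨_≈1⟩ : I.Carrier → Fin 1 → I.Carrier
    ⟨ i ≈1⟩ _ = i

    qc : ∀ i → QuasiCoherent I (𝕀/ P I i)
    qc i = sqci 1 ⟨ i ≈1⟩ ⟨ one ≈1⟩

    L→ΣAlg : LSpec.Carrier → ΣA.Carrier
    L→ΣAlg (i , f , f-const) =
      i , glueHom ⟨ i ≈1⟩ ⟨ one ≈1⟩ (qc i) (λ e → f (e zero))
                  (λ p q → f-const (p zero) (q zero))

    restrict : ∀ {i} → IHom I A (𝕀/ P I i) → i I.≈ one → IHom I A (𝕀ₐ I)
    restrict {i} h p = Quot-point ⟨ i ≈1⟩ ⟨ one ≈1⟩ (λ _ → p) ∘ᴵ h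

    ΣAlg→L : ΣA.Carrier → LSpec.Carrier
    ΣAlg→L (i , h) = i , restrict h , λ p q x → I.refl

    L→ΣAlg-β : ∀ i f f-const p x →
               IHom.to (proj₂ (L→ΣAlg (i , f , f-const))) x I.≈ IHom.to (f p) x
    L→ΣAlg-β i f f-const p =
      glueHom-β ⟨ i ≈1⟩ ⟨ one ≈1⟩ (qc i) (λ e → f (e zero))
                (λ p q → f-const (p zero) (q zero)) (λ _ → p)

    L→ΣAlg-cong : ∀ {s t} → s LSpec.≈ t → L→ΣAlg s ΣA.≈ L→ΣAlg t
    L→ΣAlg-cong {i , f , f-const} {j , g , g-const} (i≈j , f≈g) =
      i≈j , λ x → conditional⇒Gen ⟨ i ≈1⟩ ⟨ one ≈1⟩ (qc i) λ p →
        let q = I.trans (I.sym i≈j) (p zero) in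
        I.trans (L→ΣAlg-β i f f-const (p zero) x)
          (I.trans (f≈g (p zero) q x) (I.sym (L→ΣAlg-β j g g-const q x)))

    ΣAlg→L-cong : ∀ {s t} → s ΣA.≈ t → ΣAlg→L s LSpec.≈ ΣAlg→L t
    ΣAlg→L-cong {i , h} {j , k} (i≈j , h≈k) =
      i≈j , λ p q x → Gen⇒≈ ⟨ i ≈1⟩ ⟨ one ≈1⟩ (λ _ → p) (h≈k x)

    L→ΣAlg∘ΣAlg→L : ∀ s → L→ΣAlg (ΣAlg→L s) ΣA.≈ s
    L→ΣAlg∘ΣAlg→L (i , h) = I.refl , λ x → conditional⇒Gen ⟨ i ≈1⟩ ⟨ one ≈1⟩ (qc i) λ p →
      L→ΣAlg-β i (restrict h) (λ _ _ _ → I.refl) (p zero) x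

    ΣAlg→L∘L→ΣAlg : ∀ s → ΣAlg→L (L→ΣAlg s) LSpec.≈ s
    ΣAlg→L∘L→ΣAlg (i , f , f-const) = I.refl , λ p q x → L→ΣAlg-β i f f-const q x

  -- The relations of L and ΣAlg match on pairs, so their implicit arguments cannot be inferred.
  LSpec≅ΣAlg : Inverse (L P I (Spec I A)) (ΣAlg P I A)
  LSpec≅ΣAlg = record
    { to = L→ΣAlg ; from = ΣAlg→L
    ; to-cong = λ {s} {t} → L→ΣAlg-cong {s} {t}
    ; from-cong = λ {s} {t} → ΣAlg→L-cong {s} {t}
    ; inverse = (λ {s} {t} → inverseˡ {s} {t}) , (λ {s} {t} → inverseʳ {s} {t}) }
    where
      open Consequences (L P I (Spec I A)) (ΣAlg P I A)
      inverseˡ : Inverseˡ LSpec._≈_ ΣA._≈_ L→ΣAlg ΣAlg→L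
      inverseˡ {s} {t} = strictlyInverseˡ⇒inverseˡ {f = L→ΣAlg} {f⁻¹ = ΣAlg→L}
                           (λ {s} {t} → L→ΣAlg-cong {s} {t}) L→ΣAlg∘ΣAlg→L {s} {t}
      inverseʳ : Inverseʳ LSpec._≈_ ΣA._≈_ L→ΣAlg ΣAlg→L
      inverseʳ {s} {t} = strictlyInverseʳ⇒inverseʳ {f⁻¹ = ΣAlg→L} {f = L→ΣAlg}
                           (λ {s} {t} → ΣAlg→L-cong {s} {t}) ΣAlg→L∘L→ΣAlg {s} {t}

proposition4p5 : {T : Theory} (P : PropStable {T}) (I : Model {T}) →
    SQCI I → (A : IAlg I) → Inverse (L P I (Spec I A)) (ΣAlg P I A)
proposition4p5 = LSpec≅ΣAlg
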